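{- Let $k\geq 2$ and $m\geq 1$ be integers and let $p$ be an integer. Then $C_{2^{m}-1}\equiv p \pmod {2^k}$ if and only if \[ (2^{m+1}-3)!!\equiv p\prod_{n=1}^{m}(2^{n}-1)!! \pmod{2^{k}}. \]
   Context: $C_n := \frac{(2n)!}{(n+1)!\,n!}$ denotes the $n$-th Catalan number. For an integer $n\geq 0$, $(2n+1)!! := 1\times 3\times\cdots\times(2n+1)$. -}

module Defs where

open import Data.Nat using (ℕ; zero; suc; _+_; _*_; _∸_; _^_; _/_; _!)
open import Data.Nat.Properties using (_!*_!≢0)
open import Data.Integer using (ℤ; +_; _-_)
open import Data.Integer.Divisibility using (_∣_)

catalan : ℕ → ℕ
catalan n = ((2 * n) !) / ((suc n) ! * n !)
  where instance _ = (suc n) !* n !≢0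

_!! : ℕ → ℕ
zero !! = 1
suc zero !! = 1
suc (suc n) !! = suc (suc n) * (n !!)

prod1 : ℕ → (ℕ → ℕ) → ℕ
prod1 zero f = 1
prod1 (suc m) f = prod1 m f * f (suc m)

_≡_[modℤ_] : ℤ → ℤ → ℤ → Set
a ≡ b [modℤ d ] = d ∣ (a - b)

{-# OPTIONS --safe #-}
-- Separating even and odd factors gives (2n)! = 2ⁿ n! (2n−1)!!, and iterating this at
-- n = 2^(m−1), …, 2, 1 gives (2^m)! = 2^(2^m − 1) ∏_{n=1}^m (2ⁿ−1)!!.  With N = 2^m − 1,
-- substituting both into (2N)! = C_N (N+1)! N! and cancelling 2^N N! yields
-- C_N ∏_{n=1}^m (2ⁿ−1)!! = (2^(m+1) − 3)!!.  The product is odd, hence a unit modulo 2^k,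
-- so multiplying the congruence C_N ≡ p by it is an equivalence.
module Submission where

open import Defs
open import Data.Nat using (ℕ; _≤_; _+_; _∸_; _^_)
open import Data.Integer using (ℤ; +_; _*_)
open import Function.Bundles using (_⇔_)

open import Data.Nat using (zero; suc; _!; NonZero; nonTrivial⇒≢1) renaming (_*_ to _·_)
import Data.Nat.Properties as ℕₚ
open import Data.Nat.Divisibility
  using (_∤_; divides; quotient; m∣n⇒n≡quotient*m; ∣-trans; m∣m*n; *-monoʳ-∣; *-cancelˡ-∣; 1∣_; ∣1⇒≡1; n/m≡quotient)
  renaming (_∣_ to _∣ₙ_)
open import Data.Nat.Combinatorics using (k![n∸k]!∣n!)
open import Data.Nat.Primality using (Prime; prime?; euclidsLemma; prime⇒nonTrivial; prime⇒nonZero)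
open import Data.Nat.Tactic.RingSolver using (solve-∀)
import Data.Integer as ℤ
import Data.Integer.Properties as ℤₚ
import Data.Integer.Tactic.RingSolver as ℤSolver
open import Data.Sum using (inj₁; inj₂)
open import Data.Empty using (⊥-elim)
open import Function.Base using (_∘_)
open import Function.Bundles using (mk⇔)
open import Relation.Nullary.Decidable using (from-yes)
open import Relation.Binary.PropositionalEquality

open ≡-Reasoning

[1+n]!!≡[1+n]*[n∸1]!! : ∀ n → suc n !! ≡ suc n · (n ∸ 1) !!
[1+n]!!≡[1+n]*[n∸1]!! zero    = refl
[1+n]!!≡[1+n]*[n∸1]!! (suc n) = refl

n!≡n!!*[n∸1]!! : ∀ n → n ! ≡ n !! · (n ∸ 1) !!
n!≡n!!*[n∸1]!! zero    = refl
n!≡n!!*[n∸1]!! (suc n) = begin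
  suc n · n !                         ≡⟨ cong (suc n ·_) (n!≡n!!*[n∸1]!! n) ⟩
  suc n · (n !! · (n ∸ 1) !!)         ≡⟨ rearrange (suc n) (n !!) ((n ∸ 1) !!) ⟩
  (suc n · (n ∸ 1) !!) · n !!         ≡⟨ cong (_· n !!) (sym ([1+n]!!≡[1+n]*[n∸1]!! n)) ⟩
  suc n !! · n !!                     ∎
  where
  rearrange : ∀ a b c → a · (b · c) ≡ (a · c) · b
  rearrange = solve-∀

[2n]!!≡2^n*n! : ∀ n → (2 · n) !! ≡ 2 ^ n · n !
[2n]!!≡2^n*n! zero    = refl
[2n]!!≡2^n*n! (suc n) = begin
  (2 · suc n) !!                      ≡⟨ cong _!! (ℕₚ.*-suc 2 n) ⟩
  (2 + 2 · n) · (2 · n) !!            ≡⟨ cong ((2 + 2 · n) ·_) ([2n]!!≡2^n*n! n) ⟩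
  (2 + 2 · n) · (2 ^ n · n !)         ≡⟨ rearrange n (2 ^ n) (n !) ⟩
  2 · 2 ^ n · (suc n · n !)           ∎
  where
  rearrange : ∀ n a b → (2 + 2 · n) · (a · b) ≡ 2 · a · ((1 + n) · b)
  rearrange = solve-∀

[2n]!≡2^n*n!*[2n∸1]!! : ∀ n → (2 · n) ! ≡ 2 ^ n · n ! · (2 · n ∸ 1) !!
[2n]!≡2^n*n!*[2n∸1]!! n =
  trans (n!≡n!!*[n∸1]!! (2 · n)) (cong (_· (2 · n ∸ 1) !!) ([2n]!!≡2^n*n! n))

doubleFactorialProduct : ℕ → ℕ
doubleFactorialProduct m = prod1 m (λ n → (2 ^ n ∸ 1) !!)

2^n*2^[n∸1]≡2^[2n∸1] : ∀ n → 2 ^ n · 2 ^ (n ∸ 1) ≡ 2 ^ (2 · n ∸ 1)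
2^n*2^[n∸1]≡2^[2n∸1] n = trans (sym (ℕₚ.^-distribˡ-+-* 2 n (n ∸ 1))) (cong (2 ^_) (n+[n∸1]≡2n∸1 n))
  where
  n+[n∸1]≡2n∸1 : ∀ n → n + (n ∸ 1) ≡ 2 · n ∸ 1
  n+[n∸1]≡2n∸1 zero    = refl
  n+[n∸1]≡2n∸1 (suc n) = trans (1+n+n≡1+2n n) (cong (_∸ 1) (sym (ℕₚ.*-suc 2 n)))
    where
    1+n+n≡1+2n : ∀ n → suc n + n ≡ suc (2 · n)
    1+n+n≡1+2n = solve-∀

[2^m]!≡2^[2^m∸1]*∏ : ∀ m → (2 ^ m) ! ≡ 2 ^ (2 ^ m ∸ 1) · doubleFactorialProduct m
[2^m]!≡2^[2^m∸1]*∏ zero    = refl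
[2^m]!≡2^[2^m∸1]*∏ (suc m) = begin
  (2 · t) !                                     ≡⟨ [2n]!≡2^n*n!*[2n∸1]!! t ⟩
  2 ^ t · t ! · (2 · t ∸ 1) !!                  ≡⟨ cong (λ x → 2 ^ t · x · (2 · t ∸ 1) !!) ([2^m]!≡2^[2^m∸1]*∏ m) ⟩
  2 ^ t · (2 ^ (t ∸ 1) · Π) · (2 · t ∸ 1) !!    ≡⟨ rearrange (2 ^ t) (2 ^ (t ∸ 1)) Π ((2 · t ∸ 1) !!) ⟩
  (2 ^ t · 2 ^ (t ∸ 1)) · (Π · (2 · t ∸ 1) !!)  ≡⟨ cong (_· (Π · (2 · t ∸ 1) !!)) (2^n*2^[n∸1]≡2^[2n∸1] t) ⟩
  2 ^ (2 · t ∸ 1) · (Π · (2 · t ∸ 1) !!)        ∎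
  where
  t = 2 ^ m
  Π = doubleFactorialProduct m
  rearrange : ∀ a b c d → a · (b · c) · d ≡ (a · b) · (c · d)
  rearrange = solve-∀

n!*n!∣[2n]! : ∀ n → n ! · n ! ∣ₙ (2 · n) !
n!*n!∣[2n]! n = subst (λ i → n ! · i ! ∣ₙ (2 · n) !) 2n∸n≡n (k![n∸k]!∣n! (ℕₚ.m≤n*m n 2))
  where
  2n∸n≡n : 2 · n ∸ n ≡ n
  2n∸n≡n = trans (ℕₚ.m+n∸m≡n n (n + 0)) (ℕₚ.+-identityʳ n)

[2+n]!*n!∣[2[1+n]]! : ∀ n → suc (suc n) ! · n ! ∣ₙ (2 · suc n) !
[2+n]!*n!∣[2[1+n]]! n = subst (λ i → suc (suc n) ! · n ! ∣ₙ i !) (sym (2[1+n]≡[2+n]+n n)) [2+n]!n!∣[[2+n]+n]!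
  where
  2[1+n]≡[2+n]+n : ∀ n → 2 · suc n ≡ suc (suc n) + n
  2[1+n]≡[2+n]+n = solve-∀
  [2+n]!n!∣[[2+n]+n]! : suc (suc n) ! · n ! ∣ₙ (suc (suc n) + n) !
  [2+n]!n!∣[[2+n]+n]! = subst (λ i → suc (suc n) ! · i ! ∣ₙ (suc (suc n) + n) !) (ℕₚ.m+n∸m≡n (suc (suc n)) n)
    (k![n∸k]!∣n! (ℕₚ.m≤m+n (suc (suc n)) n))

-- (2n)! = (n+1)·(2n)! − n·(2n)!, and both terms are multiples of (n+1)!n! since
-- n!n! and (n+1)!(n−1)! divide (2n)!; that is, C_n = binom(2n,n) − binom(2n,n+1).
[1+n]!*n!∣[2n]! : ∀ n → suc n ! · n ! ∣ₙ (2 · n) !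
[1+n]!*n!∣[2n]! zero        = divides 1 refl
[1+n]!*n!∣[2n]! n@(suc n-1) = divides (a ∸ b) (begin
  X                                                         ≡⟨ sym (ℕₚ.m+n∸n≡m X (n · X)) ⟩
  (1 + n) · X ∸ n · X                                       ≡⟨ cong₂ (λ u v → (1 + n) · u ∸ n · v) X≡a*n!*n! X≡b*[1+n]!*[n-1]! ⟩
  (1 + n) · (a · (n ! · n !)) ∸ n · (b · (suc n ! · n-1 !)) ≡⟨ cong₂ _∸_ (shuffleˡ a n (n-1 !)) (shuffleʳ b n (n-1 !)) ⟩
  a · Q ∸ b · Q                                             ≡⟨ sym (ℕₚ.*-distribʳ-∸ Q a b) ⟩
  (a ∸ b) · Q                                               ∎)
  where
  X = (2 · n) !
  Q = suc n ! · n !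
  a = quotient (n!*n!∣[2n]! n)
  b = quotient ([2+n]!*n!∣[2[1+n]]! n-1)
  X≡a*n!*n! : X ≡ a · (n ! · n !)
  X≡a*n!*n! = m∣n⇒n≡quotient*m (n!*n!∣[2n]! n)
  X≡b*[1+n]!*[n-1]! : X ≡ b · (suc n ! · n-1 !)
  X≡b*[1+n]!*[n-1]! = m∣n⇒n≡quotient*m ([2+n]!*n!∣[2[1+n]]! n-1)
  shuffleˡ : ∀ a n F → (1 + n) · (a · ((n · F) · (n · F))) ≡ a · ((1 + n) · (n · F) · (n · F))
  shuffleˡ = solve-∀
  shuffleʳ : ∀ b n F → n · (b · ((1 + n) · (n · F) · F)) ≡ b · ((1 + n) · (n · F) · (n · F))
  shuffleʳ = solve-∀

[2n]!≡catalan*[1+n]!*n! : ∀ n → (2 · n) ! ≡ catalan n · (suc n ! · n !)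
[2n]!≡catalan*[1+n]!*n! n = trans (m∣n⇒n≡quotient*m Q∣X) (cong (_· (suc n ! · n !)) (sym catalan≡quotient))
  where
  instance _ = suc n ℕₚ.!* n !≢0
  Q∣X : suc n ! · n ! ∣ₙ (2 · n) !
  Q∣X = [1+n]!*n!∣[2n]! n
  catalan≡quotient : catalan n ≡ quotient Q∣X
  catalan≡quotient = n/m≡quotient Q∣X

catalan[2^m∸1]*∏≡[2[2^m∸1]∸1]!! : ∀ m → catalan (2 ^ m ∸ 1) · doubleFactorialProduct m ≡ (2 · (2 ^ m ∸ 1) ∸ 1) !!
catalan[2^m∸1]*∏≡[2[2^m∸1]∸1]!! m = ℕₚ.*-cancelʳ-≡ (c · Π) ((2 · N ∸ 1) !!) (2 ^ N · N !) {{2^N*N!≢0}} (begin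
  (c · Π) · (2 ^ N · N !)      ≡⟨ rearrange c Π (2 ^ N) (N !) ⟩
  c · (2 ^ N · Π · N !)        ≡⟨ cong (λ x → c · (x · N !)) (sym ([2^m]!≡2^[2^m∸1]*∏ m)) ⟩
  c · ((2 ^ m) ! · N !)        ≡⟨ cong (λ x → c · (x ! · N !)) (sym 1+N≡2^m) ⟩
  c · (suc N ! · N !)          ≡⟨ sym ([2n]!≡catalan*[1+n]!*n! N) ⟩
  (2 · N) !                    ≡⟨ [2n]!≡2^n*n!*[2n∸1]!! N ⟩
  2 ^ N · N ! · (2 · N ∸ 1) !! ≡⟨ ℕₚ.*-comm (2 ^ N · N !) ((2 · N ∸ 1) !!) ⟩
  (2 · N ∸ 1) !! · (2 ^ N · N !) ∎)
  where
  N = 2 ^ m ∸ 1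
  c = catalan N
  Π = doubleFactorialProduct m
  1+N≡2^m : suc N ≡ 2 ^ m
  1+N≡2^m = ℕₚ.suc-pred (2 ^ m) {{ℕₚ.m^n≢0 2 m}}
  2^N*N!≢0 : NonZero (2 ^ N · N !)
  2^N*N!≢0 = ℕₚ.m*n≢0 (2 ^ N) (N !) {{ℕₚ.m^n≢0 2 N}} {{N ℕₚ.!≢0}}
  rearrange : ∀ a b c d → (a · b) · (c · d) ≡ a · (c · b · d)
  rearrange = solve-∀

2^[m+1]∸3≡2[2^m∸1]∸1 : ∀ m → 2 ^ (m + 1) ∸ 3 ≡ 2 · (2 ^ m ∸ 1) ∸ 1
2^[m+1]∸3≡2[2^m∸1]∸1 m = cong (_∸ 3) (begin
  2 ^ (m + 1)            ≡⟨ cong (2 ^_) (ℕₚ.+-comm m 1) ⟩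
  2 · 2 ^ m              ≡⟨ cong (2 ·_) (sym (ℕₚ.suc-pred (2 ^ m) {{ℕₚ.m^n≢0 2 m}})) ⟩
  2 · suc (2 ^ m ∸ 1)    ≡⟨ ℕₚ.*-suc 2 (2 ^ m ∸ 1) ⟩
  2 + 2 · (2 ^ m ∸ 1)    ∎)

prime∤1 : ∀ {p} → Prime p → p ∤ 1
prime∤1 pp p∣1 = nonTrivial⇒≢1 {{prime⇒nonTrivial pp}} (∣1⇒≡1 p∣1)

p∤m→p∤n→p∤m*n : ∀ {p m n} → Prime p → p ∤ m → p ∤ n → p ∤ m · n
p∤m→p∤n→p∤m*n {m = m} {n} pp p∤m p∤n p∣mn with euclidsLemma m n pp p∣mn
... | inj₁ p∣m = p∤m p∣m
... | inj₂ p∣n = p∤n p∣n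

p∤prod1 : ∀ {p} {f : ℕ → ℕ} → Prime p → (∀ n → p ∤ f n) → ∀ m → p ∤ prod1 m f
p∤prod1 pp p∤f zero    = prime∤1 pp
p∤prod1 pp p∤f (suc m) = p∤m→p∤n→p∤m*n pp (p∤prod1 pp p∤f m) (p∤f (suc m))

2∤1+2n : ∀ n → 2 ∤ suc (2 · n)
2∤1+2n n (divides q 1+2n≡q*2) = ℕₚ.even≢odd q n (sym (trans 1+2n≡q*2 (ℕₚ.*-comm q 2)))

2-prime : Prime 2
2-prime = from-yes (prime? 2)

2∤[2n∸1]!! : ∀ n → 2 ∤ (2 · n ∸ 1) !!
2∤[2n∸1]!! zero    = prime∤1 2-prime
2∤[2n∸1]!! (suc n) =
  subst (2 ∤_) (sym [2[1+n]∸1]!!≡[1+2n]*[2n∸1]!!) (p∤m→p∤n→p∤m*n 2-prime (2∤1+2n n) (2∤[2n∸1]!! n))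
  where
  [2[1+n]∸1]!!≡[1+2n]*[2n∸1]!! : (2 · suc n ∸ 1) !! ≡ suc (2 · n) · (2 · n ∸ 1) !!
  [2[1+n]∸1]!!≡[1+2n]*[2n∸1]!! =
    trans (cong (λ i → (i ∸ 1) !!) (ℕₚ.*-suc 2 n)) ([1+n]!!≡[1+n]*[n∸1]!! (2 · n))

2∤∏ : ∀ m → 2 ∤ doubleFactorialProduct m
2∤∏ = p∤prod1 2-prime 2∤[2^n∸1]!!
  where
  2∤[2^n∸1]!! : ∀ n → 2 ∤ (2 ^ n ∸ 1) !!
  2∤[2^n∸1]!! zero    = prime∤1 2-prime
  2∤[2^n∸1]!! (suc n) = 2∤[2n∸1]!! (2 ^ n)

p^k∣m*n⇒p^k∣m : ∀ {p n} k {m} → Prime p → p ∤ n → p ^ k ∣ₙ m · n → p ^ k ∣ₙ m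
p^k∣m*n⇒p^k∣m zero                pp p∤n _        = 1∣ _
p^k∣m*n⇒p^k∣m {p} {n} (suc k) {m} pp p∤n p^[1+k]∣mn
  with euclidsLemma m n pp (∣-trans (m∣m*n (p ^ k)) p^[1+k]∣mn)
... | inj₂ p∣n = ⊥-elim (p∤n p∣n)
... | inj₁ (divides q m≡q*p) =
  subst (p ^ suc k ∣ₙ_) (trans (ℕₚ.*-comm p q) (sym m≡q*p)) (*-monoʳ-∣ p p^k∣q)
  where
  instance _ = prime⇒nonZero pp
  p*p^k∣p*qn : p · p ^ k ∣ₙ p · (q · n)
  p*p^k∣p*qn = subst (p · p ^ k ∣ₙ_) (trans (cong (_· n) (trans m≡q*p (ℕₚ.*-comm q p))) (ℕₚ.*-assoc p q n)) p^[1+k]∣mn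
  p^k∣q : p ^ k ∣ₙ q
  p^k∣q = p^k∣m*n⇒p^k∣m k pp p∤n (*-cancelˡ-∣ p p*p^k∣p*qn)

∣a*c-b*c∣≡∣a-b∣*∣c∣ : ∀ a b c → ℤ.∣ a * c ℤ.- b * c ∣ ≡ ℤ.∣ a ℤ.- b ∣ · ℤ.∣ c ∣
∣a*c-b*c∣≡∣a-b∣*∣c∣ a b c = trans (cong ℤ.∣_∣ (a*c-b*c≡[a-b]*c a b c)) (ℤₚ.abs-* (a ℤ.- b) c)
  where
  a*c-b*c≡[a-b]*c : ∀ a b c → a * c ℤ.- b * c ≡ (a ℤ.- b) * c
  a*c-b*c≡[a-b]*c = ℤSolver.solve-∀

*-congʳ-modℤ : ∀ {a b d : ℤ} (c : ℤ) → a ≡ b [modℤ d ] → (a * c) ≡ (b * c) [modℤ d ]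
*-congʳ-modℤ {a} {b} {d} c d∣a-b = subst (ℤ.∣ d ∣ ∣ₙ_) (sym (∣a*c-b*c∣≡∣a-b∣*∣c∣ a b c)) (∣-trans d∣a-b (m∣m*n ℤ.∣ c ∣))

*-cancelʳ-modℤ : ∀ {p} k {a b c : ℤ} → Prime p → p ∤ ℤ.∣ c ∣ → (a * c) ≡ (b * c) [modℤ + (p ^ k) ] → a ≡ b [modℤ + (p ^ k) ]
*-cancelʳ-modℤ {p} k {a} {b} {c} pp p∤c p^k∣ac-bc =
  p^k∣m*n⇒p^k∣m k pp p∤c (subst (p ^ k ∣ₙ_) (∣a*c-b*c∣≡∣a-b∣*∣c∣ a b c) p^k∣ac-bc)

lemma3p1 : (k m : ℕ) → 2 ≤ k → 1 ≤ m → (p : ℤ) →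
    ((+ catalan (2 ^ m ∸ 1)) ≡ p [modℤ + (2 ^ k) ])
      ⇔ ((+ ((2 ^ (m + 1) ∸ 3) !!)) ≡ p * (+ prod1 m (λ n → (2 ^ n ∸ 1) !!)) [modℤ + (2 ^ k) ])
lemma3p1 k m _ _ p = mk⇔ to from
  where
  Π = doubleFactorialProduct m
  C D : ℤ
  C = + catalan (2 ^ m ∸ 1)
  D = + ((2 ^ (m + 1) ∸ 3) !!)
  C*Π≡D : C * + Π ≡ D
  C*Π≡D = begin
    + catalan (2 ^ m ∸ 1) * + Π          ≡⟨ ℤₚ.pos-* (catalan (2 ^ m ∸ 1)) Π ⟨
    + (catalan (2 ^ m ∸ 1) · Π)          ≡⟨ cong +_ (catalan[2^m∸1]*∏≡[2[2^m∸1]∸1]!! m) ⟩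
    + ((2 · (2 ^ m ∸ 1) ∸ 1) !!)         ≡⟨ cong (λ i → + (i !!)) (2^[m+1]∸3≡2[2^m∸1]∸1 m) ⟨
    D                                    ∎
  to : C ≡ p [modℤ + (2 ^ k) ] → D ≡ (p * + Π) [modℤ + (2 ^ k) ]
  to = subst (_≡ (p * + Π) [modℤ + (2 ^ k) ]) C*Π≡D ∘ *-congʳ-modℤ {C} {p} {+ (2 ^ k)} (+ Π)
  from : D ≡ (p * + Π) [modℤ + (2 ^ k) ] → C ≡ p [modℤ + (2 ^ k) ]
  from = *-cancelʳ-modℤ k {C} {p} {+ Π} 2-prime (2∤∏ m) ∘ subst (_≡ (p * + Π) [modℤ + (2 ^ k) ]) (sym C*Π≡D)
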